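{- Let $t\ge2$, $A=\{0,1,\ldots,t-1\}$ and $n\ge1$. Let $S=(b_1,\ldots,b_{t^n+n-1})$ be a de Bruijn sequence of order $n$ over $A$ started at $0^n$ with preference function complexity $\mathrm{comp}_{0}(S)=0$. Then there exists a permutation $\sigma$ of $A$ such that $b_i=\sigma(a_i)$ for all $i$, where $(a_i)$ is the Ford sequence of order $n$ over $A$.
   Context: A de Bruijn sequence of order $n$ over $A$ is a finite sequence of $t^n+n-1$ symbols of $A$ in which every word of length $n$ appears exactly once as a block of contiguous symbols; it is started at $0^n$ if its first $n$ symbols are $0$. A preference function $P$ of span $r$ assigns to each $\mathbf a\in A^{r}$ (for $r=0$, $A^0$ is just the empty word, so $P$ is a single ordering of $A$) a vector $(P_1(\mathbf a),\ldots,P_t(\mathbf a))$ whose entries form a permutation of $A$. For $0\le r\le n$, the sequence of order $n$ generated by $P$ from $0^n$ is: $a_1=\cdots=a_n=0$; if $a_{N+1},\ldots,a_{N+n-1}$ have been defined (starting with $N=1$), set $a_{N+n}=P_i(a_{N+n-r},\ldots,a_{N+n-1})$ where $i$ is the smallest index such that the word $(a_{N+1},\ldots,a_{N+n-1},P_i(a_{N+n-r},\ldots,a_{N+n-1}))$ has not previously appeared as a block of contiguous symbols of the sequence; if no such $i$ exists, the sequence ends at $a_{N+n-1}$. $\mathrm{comp}_{0}(S)$ is the smallest $r$, $0\le r\le n$, such that some preference function of span $r$ generates $S$ from $0^n$. The Ford sequence of order $n$ is the sequence generated in this way by the span-$0$ preference function $(t-1,t-2,\ldots,0)$, i.e. start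 with $n$ zeros and repeatedly append the largest digit that creates a length-$n$ block not seen before, stopping when no digit does. -}

module Defs where

open import Data.Nat using (ℕ; zero; suc; _+_; _∸_; _^_; _≤_; _<_; _≤?_; NonZero; >-nonZero⁻¹)
open import Data.Fin using (Fin; fromℕ<; opposite)
open import Data.Fin.Properties using () renaming (_≟_ to _≟ᶠ_)
open import Data.Fin.Permutation using (Permutation′; _⟨$⟩ʳ_)
open import Data.List as List using (List; []; _∷_; _++_; [_]; length; take; drop; replicate; filter; reverse; allFin)
open import Data.List.Properties using (≡-dec)
open import Data.Vec as Vec using (Vec)
open import Data.Maybe as Maybe using (Maybe; just; nothing)
open import Data.Product using (Σ; ∃; _×_; _,_)
open import Relation.Nullary using (yes; no; Dec)
open import Relation.Binary.PropositionalEquality using (_≡_)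

-- The alphabet A = {0,…,t-1} is Fin t; finite sequences are lists over Fin t.

𝟘 : {t : ℕ} .{{_ : NonZero t}} → Fin t
𝟘 {t} = fromℕ< (>-nonZero⁻¹ t)

_≟w_ : {t : ℕ} → (u v : List (Fin t)) → Dec (u ≡ v)
_≟w_ = ≡-dec _≟ᶠ_

blocks : {A : Set} → ℕ → List A → List (List A)
blocks n [] = []
blocks n (x ∷ xs) with n ≤? length (x ∷ xs)
... | yes _ = take n (x ∷ xs) ∷ blocks n xs
... | no  _ = []

occurrences : {t : ℕ} → List (Fin t) → List (Fin t) → ℕ
occurrences {t} w S = length (filter (λ u → w ≟w u) (blocks (length w) S))

IsDeBruijn : (t n : ℕ) → List (Fin t) → Set
IsDeBruijn t n S =
  (length S ≡ t ^ n + n ∸ 1) ×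
  ((w : Vec (Fin t) n) → occurrences (Vec.toList w) S ≡ 1)

StartsAtZero : (t n : ℕ) .{{_ : NonZero t}} → List (Fin t) → Set
StartsAtZero t n S = take n S ≡ replicate n 𝟘

-- A preference function of span r: to each a ∈ A^r a permutation of A;
-- P_i(a) (1-based i) is  (P a) ⟨$⟩ʳ (i-1).
PreferenceFunction : (t r : ℕ) → Set
PreferenceFunction t r = Vec (Fin t) r → Permutation′ t

takeVec : {A : Set} (r : ℕ) → List A → Maybe (Vec A r)
takeVec zero    _        = just Vec.[]
takeVec (suc r) []       = nothing
takeVec (suc r) (x ∷ xs) = Maybe.map (x Vec.∷_) (takeVec r xs)

lastVec : {A : Set} (r : ℕ) → List A → Maybe (Vec A r)
lastVec r xs = Maybe.map Vec.reverse (takeVec r (reverse xs))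

lastL : {A : Set} → ℕ → List A → List A
lastL k xs = drop (length xs ∸ k) xs

module Generation {t : ℕ} (n r : ℕ) (P : Vec (Fin t) r → Fin t → Fin t) where
  -- P c i  is the (i+1)-th preferred symbol after context c
  open import Data.List.Membership.DecPropositional (_≟w_ {t}) using (_∈?_)

  firstFresh : List (Fin t) → List (Fin t) → Maybe (Fin t)
  firstFresh seq []       = nothing
  firstFresh seq (x ∷ xs) with (lastL (n ∸ 1) seq ++ [ x ]) ∈? blocks n seq
  ... | yes _ = firstFresh seq xs
  ... | no  _ = just x

  next : List (Fin t) → Maybe (Fin t)
  next seq with lastVec r seq
  ... | nothing = nothing
  ... | just c  = firstFresh seq (List.map (P c) (allFin t))

  run : ℕ → List (Fin t) → List (Fin t)
  run zero       seq = seq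
  run (suc fuel) seq with next seq
  ... | nothing = seq
  ... | just x  = run fuel (seq ++ [ x ])

-- The sequence of order n generated from 0^n by the rule P.  Every step
-- creates a new block of length n among the t^n possible ones, so the
-- process stops after fewer than t^n steps; fuel t^n is therefore enough.
generateRaw : (t n r : ℕ) .{{_ : NonZero t}} → (Vec (Fin t) r → Fin t → Fin t) → List (Fin t)
generateRaw t n r P = Generation.run n r P (t ^ n) (replicate n 𝟘)

generate : (t n r : ℕ) .{{_ : NonZero t}} → PreferenceFunction t r → List (Fin t)
generate t n r P = generateRaw t n r (λ c i → P c ⟨$⟩ʳ i)

GeneratedWithSpan : (t n r : ℕ) .{{_ : NonZero t}} → List (Fin t) → Set
GeneratedWithSpan t n r S = Σ (PreferenceFunction t r) λ P → generate t n r P ≡ S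

-- comp₀(S) = 0, i.e. the least span r (0 ≤ r ≤ n) of a preference function
-- generating S from 0^n is 0; equivalently, span 0 works.
Comp₀IsZero : (t n : ℕ) .{{_ : NonZero t}} → List (Fin t) → Set
Comp₀IsZero t n S = GeneratedWithSpan t n 0 S

-- Ford sequence: span-0 preference (t-1, t-2, …, 0), i.e. P_i = t - i
ford : (t n : ℕ) .{{_ : NonZero t}} → List (Fin t)
ford t n = generateRaw t n 0 (λ _ i → opposite i)

module Submission where

-- Call a preference order π′ a normal form of the rule if it
-- prefers 0 least and makes the same choices as π on every sequence
-- containing 0.  (i) For n = 1, moving 0 to the end of π gives a normal
-- form, since 0 is used from the start.  (ii) For n ≥ 2, π itself is
-- normal: if its least preferred symbol were y ≠ 0, then once the block y^n
-- appears every extension of y^(n-1) is used, so S ends with y^(n-1); but a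
-- de Bruijn sequence starts with an (n-1)-word iff it ends with it (count
-- the occurrences of that word by predecessors and by successors), and S
-- starts with 0.  (iii) With σ = π′ ∘ opposite, the rule makes at each step
-- the σ-image of Ford's choice, so by simulation S = σ(Ford).

open import Defs
open import Data.Empty using (⊥; ⊥-elim)
open import Data.Fin using (Fin; zero; suc; toℕ; fromℕ; punchIn; opposite)
open import Data.Fin.Permutation
  using (Permutation′; _⟨$⟩ʳ_; _⟨$⟩ˡ_; inverseˡ; inverseʳ; insert; insert-punchIn; _∘ₚ_; reverse) renaming (id to idₚ)
open import Data.Fin.Properties using (punchInᵢ≢i; ≤fromℕ; toℕ-injective; opposite-involutive) renaming (_≟_ to _≟ᶠ_)
open import Data.List using (List; []; _∷_; _++_; [_]; length; take; drop; replicate; map; filter; tabulate; allFin)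
open import Data.List.Membership.Propositional using (_∈_)
open import Data.List.Membership.Propositional.Properties using (∈-map⁻; ∈-map⁺; ∈-++⁺ˡ; ∈-++⁺ʳ; ∈-++⁻)
open import Data.List.Properties
  using (length-++; length-map; length-take; length-replicate; take-all; take-map; drop-map; drop-drop; drop-all;
         ∷-injective; ∷ʳ-injective; map-injective; map-++; map-∘; map-replicate; map-tabulate; tabulate-cong; ++-assoc)
open import Data.List.Relation.Unary.Any using (here; there)
open import Data.Maybe as Maybe using (just; nothing)
open import Data.Nat using (ℕ; zero; suc; _+_; _∸_; _^_; _≤_; _<_; _≤?_; z≤n; s≤s; NonZero)
open import Data.Nat.Properties
open import Algebra.Properties.CommutativeMonoid.Sum +-0-commutativeMonoid
  using (sum; sum-syntax; sum-cong-≗; ∑-distrib-+; sum-remove; sum-replicate-zero)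
open import Data.Nat.Solver using (module +-*-Solver)
open import Data.Product using (Σ; ∃; _×_; _,_; proj₁; proj₂)
open import Data.Sum using (inj₁; inj₂)
open import Data.Vec using (Vec; []; toList; fromList)
open import Data.Vec.Properties using (toList∘fromList)
open import Function.Definitions using (Injective)
open import Relation.Binary.PropositionalEquality hiding ([_])
open import Relation.Nullary using (yes; no; Dec; ¬_)

module _ {A : Set} where

  blocks-short : (n : ℕ) (xs : List A) → length xs < n → blocks n xs ≡ []
  blocks-short n []       _  = refl
  blocks-short n (x ∷ xs) lt with n ≤? length (x ∷ xs)
  ... | yes le = ⊥-elim (<⇒≱ lt le)
  ... | no  _  = refl

  blocks-long : (n : ℕ) (x : A) (xs : List A) → n ≤ length (x ∷ xs) →
    blocks n (x ∷ xs) ≡ take n (x ∷ xs) ∷ blocks n xs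
  blocks-long n x xs le with n ≤? length (x ∷ xs)
  ... | yes _  = refl
  ... | no  ¬p = ⊥-elim (¬p le)

  blocks-exact : (n : ℕ) (x : A) (xs : List A) → length (x ∷ xs) ≡ n → blocks n (x ∷ xs) ≡ [ x ∷ xs ]
  blocks-exact n x xs refl =
    trans (blocks-long n x xs ≤-refl)
          (cong₂ _∷_ (take-all n (x ∷ xs) ≤-refl) (blocks-short n xs ≤-refl))

  length-snoc : (s : List A) (x : A) → length (s ++ [ x ]) ≡ suc (length s)
  length-snoc s x = trans (length-++ s) (+-comm (length s) 1)

  take-snoc : (k : ℕ) (s : List A) (x : A) → k ≤ length s → take k (s ++ [ x ]) ≡ take k s
  take-snoc zero    s       x _         = refl
  take-snoc (suc k) (a ∷ s) x (s≤s le) = cong (a ∷_) (take-snoc k s x le)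

  drop-snoc : (k : ℕ) (s : List A) (x : A) → k ≤ length s → drop k (s ++ [ x ]) ≡ drop k s ++ [ x ]
  drop-snoc zero    s       x _         = refl
  drop-snoc (suc k) (a ∷ s) x (s≤s le) = drop-snoc k s x le

  lastL-short : (j : ℕ) (s : List A) → length s ≤ j → lastL j s ≡ s
  lastL-short j s le = cong (λ d → drop d s) (m≤n⇒m∸n≡0 le)

  lastL-cons : (j : ℕ) (a : A) (s : List A) → j ≤ length s → lastL j (a ∷ s) ≡ lastL j s
  lastL-cons j a s le = cong (λ d → drop d (a ∷ s)) (+-∸-assoc 1 le)

  lastL-snoc : (j : ℕ) (s : List A) (x : A) → j ≤ length s → lastL (suc j) (s ++ [ x ]) ≡ lastL j s ++ [ x ]
  lastL-snoc j s x le rewrite length-snoc s x = drop-snoc (length s ∸ j) s x (m∸n≤m (length s) j)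

  lastL-tail : (j : ℕ) (s : List A) → suc j ≤ length s → lastL j s ≡ drop 1 (lastL (suc j) s)
  lastL-tail j s le = begin
    drop (length s ∸ j) s              ≡⟨ cong (λ d → drop d s) (+-∸-assoc 1 le) ⟩
    drop (suc (length s ∸ suc j)) s    ≡⟨ cong (λ d → drop d s) (+-comm 1 (length s ∸ suc j)) ⟩
    drop (length s ∸ suc j + 1) s      ≡⟨ sym (drop-drop (length s ∸ suc j) 1 s) ⟩
    drop 1 (lastL (suc j) s)           ∎
    where open ≡-Reasoning

  blocks-snoc : (m : ℕ) (s : List A) (x : A) → m ≤ length s →
    blocks (suc m) (s ++ [ x ]) ≡ blocks (suc m) s ++ [ lastL m s ++ [ x ] ]
  blocks-snoc zero [] x z≤n = refl
  blocks-snoc m (a ∷ s) x le with m ≤? length s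
  ... | yes m≤s = begin
      blocks (suc m) (a ∷ s ++ [ x ])
        ≡⟨ blocks-long (suc m) a (s ++ [ x ]) (s≤s (subst (m ≤_) (sym (length-snoc s x)) (m≤n⇒m≤1+n m≤s))) ⟩
      (a ∷ take m (s ++ [ x ])) ∷ blocks (suc m) (s ++ [ x ])
        ≡⟨ cong₂ (λ u bs → (a ∷ u) ∷ bs) (take-snoc m s x m≤s) (blocks-snoc m s x m≤s) ⟩
      (a ∷ take m s) ∷ blocks (suc m) s ++ [ lastL m s ++ [ x ] ]
        ≡⟨ cong₂ (λ bs u → bs ++ [ u ++ [ x ] ]) (sym (blocks-long (suc m) a s (s≤s m≤s))) (sym (lastL-cons m a s m≤s)) ⟩
      blocks (suc m) (a ∷ s) ++ [ lastL m (a ∷ s) ++ [ x ] ] ∎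
    where open ≡-Reasoning
  ... | no m≰s = begin
      blocks (suc m) (a ∷ s ++ [ x ])
        ≡⟨ blocks-exact (suc m) a (s ++ [ x ]) (cong suc (trans (length-snoc s x) (sym m≡))) ⟩
      [ a ∷ s ++ [ x ] ]
        ≡⟨ cong₂ (λ bs u → bs ++ [ u ++ [ x ] ]) (sym (blocks-short (suc m) (a ∷ s) (s≤s (≤-reflexive (sym m≡)))))
                                                (sym (lastL-short m (a ∷ s) (≤-reflexive (sym m≡)))) ⟩
      blocks (suc m) (a ∷ s) ++ [ lastL m (a ∷ s) ++ [ x ] ] ∎
    where
    open ≡-Reasoning
    m≡ : m ≡ suc (length s)
    m≡ = ≤-antisym le (≰⇒> m≰s)

  singleton-block : {x : A} (xs : List A) → x ∈ xs → [ x ] ∈ blocks 1 xs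
  singleton-block (y ∷ ys) x∈ rewrite blocks-long 1 y ys (s≤s z≤n) with x∈
  ... | here x≡y  = here (cong [_] x≡y)
  ... | there x∈ys = there (singleton-block ys x∈ys)

  replicate-snoc : (m : ℕ) (y : A) → replicate (suc m) y ≡ replicate m y ++ [ y ]
  replicate-snoc zero    y = refl
  replicate-snoc (suc m) y = cong (y ∷_) (replicate-snoc m y)

  constant-suffix-snoc : (m : ℕ) (y : A) (s : List A) → m ≤ length s →
    lastL m s ≡ replicate m y → lastL m (s ++ [ y ]) ≡ replicate m y
  constant-suffix-snoc zero    y s _  _    = drop-all (length (s ++ [ y ])) (s ++ [ y ]) ≤-refl
  constant-suffix-snoc (suc j) y s le tail≡ = begin
    lastL (suc j) (s ++ [ y ])   ≡⟨ lastL-snoc j s y (≤-trans (n≤1+n j) le) ⟩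
    lastL j s ++ [ y ]           ≡⟨ cong (_++ [ y ]) (trans (lastL-tail j s le) (cong (drop 1) tail≡)) ⟩
    replicate j y ++ [ y ]       ≡⟨ sym (replicate-snoc j y) ⟩
    replicate (suc j) y          ∎
    where open ≡-Reasoning

module _ {A B : Set} (f : A → B) where

  lastL-map : (k : ℕ) (s : List A) → lastL k (map f s) ≡ map f (lastL k s)
  lastL-map k s rewrite length-map f s = drop-map (length s ∸ k) s

  blocks-map : (n : ℕ) (s : List A) → blocks n (map f s) ≡ map (map f) (blocks n s)
  blocks-map n []       = refl
  blocks-map n (x ∷ xs) with n ≤? length (x ∷ xs)
  ... | yes le = trans (blocks-long n (f x) (map f xs) (subst (n ≤_) (sym (length-map f (x ∷ xs))) le))
                       (cong₂ _∷_ (take-map n (x ∷ xs)) (blocks-map n xs))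
  ... | no  ¬le = blocks-short n (map f (x ∷ xs)) (subst (_< n) (sym (length-map f (x ∷ xs))) (≰⇒> ¬le))

  ∈-map-map⁻ : Injective _≡_ _≡_ f → {w : List A} {bs : List (List A)} →
    map f w ∈ map (map f) bs → w ∈ bs
  ∈-map-map⁻ f-inj fw∈ with ∈-map⁻ (map f) fw∈
  ... | v , v∈ , fw≡fv = subst (_∈ _) (sym (map-injective f-inj fw≡fv)) v∈

sum-single : ∀ {k} (x : Fin k) (f : Fin k → ℕ) → (∀ z → z ≢ x → f z ≡ 0) → sum f ≡ f x
sum-single {suc k} x f vanishes = begin
  sum f                               ≡⟨ sum-remove {i = x} f ⟩
  f x + sum (λ z → f (punchIn x z))   ≡⟨ cong (f x +_) (sum-cong-≗ (λ z → vanishes (punchIn x z) (punchInᵢ≢i x z))) ⟩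
  f x + sum {k} (λ _ → 0)             ≡⟨ cong (f x +_) (sum-replicate-zero k) ⟩
  f x + 0                             ≡⟨ +-identityʳ (f x) ⟩
  f x                                 ∎
  where open ≡-Reasoning

sum-ones : (k : ℕ) → ∑[ z < k ] 1 ≡ k
sum-ones zero    = refl
sum-ones (suc k) = cong suc (sum-ones k)

-- The two
-- decompositions below count the occurrences of a word w by what precedes
-- and by what follows them; the only occurrences without a predecessor
-- (successor) are at the start (end) of the sequence.
module Counting {t : ℕ} where

  private
    Word : Set
    Word = List (Fin t)

  indicator : {P : Set} → Dec P → ℕ
  indicator (yes _) = 1
  indicator (no  _) = 0

  indicator-no : {w v : Word} → w ≢ v → indicator (w ≟w v) ≡ 0
  indicator-no {w} {v} w≢v with w ≟w v
  ... | yes w≡v = ⊥-elim (w≢v w≡v)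
  ... | no  _   = refl

  indicator-yes : {w v : Word} → w ≡ v → indicator (w ≟w v) ≡ 1
  indicator-yes {w} {v} w≡v with w ≟w v
  ... | yes _   = refl
  ... | no  w≢v = ⊥-elim (w≢v w≡v)

  isPrefix isSuffix : Word → Word → ℕ
  isPrefix w S = indicator (w ≟w take (length w) S)
  isSuffix w S = indicator (w ≟w lastL (length w) S)

  length-≢ : {w v : Word} → length v < length w → w ≢ v
  length-≢ lt refl = <-irrefl refl lt

  length-take< : (k : ℕ) (s : Word) → length s < k → length (take k s) < k
  length-take< k s lt rewrite length-take k s = subst (_< k) (sym (m≥n⇒m⊓n≡n (<⇒≤ lt))) lt

  occurrences-cons : (w : Word) (x : Fin t) (xs : Word) →
    occurrences w (x ∷ xs) ≡ isPrefix w (x ∷ xs) + occurrences w xs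
  occurrences-cons w x xs with length w ≤? length (x ∷ xs)
  ... | yes _ with w ≟w take (length w) (x ∷ xs)
  ...   | yes _ = refl
  ...   | no  _ = refl
  occurrences-cons w x xs | no ¬le = sym (cong₂ _+_
    (indicator-no (length-≢ (length-take< (length w) (x ∷ xs) (≰⇒> ¬le))))
    (cong (λ bs → length (filter (w ≟w_) bs)) (blocks-short (length w) xs (<-trans (n<1+n (length xs)) (≰⇒> ¬le)))))

  isPrefix-cons-≡ : (a : Fin t) (w S : Word) → isPrefix (a ∷ w) (a ∷ S) ≡ isPrefix w S
  isPrefix-cons-≡ a w S with w ≟w take (length w) S | (a ∷ w) ≟w (a ∷ take (length w) S)
  ... | yes _   | yes _   = refl
  ... | no  _   | no  _   = refl
  ... | yes w≡  | no  aw≢ = ⊥-elim (aw≢ (cong (a ∷_) w≡))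
  ... | no  w≢  | yes aw≡ = ⊥-elim (w≢ (proj₂ (∷-injective aw≡)))

  isPrefix-cons-≢ : {a s : Fin t} (w S : Word) → a ≢ s → isPrefix (a ∷ w) (s ∷ S) ≡ 0
  isPrefix-cons-≢ w S a≢s = indicator-no (λ eq → a≢s (proj₁ (∷-injective eq)))

  sum-zeros : (f : Fin t → ℕ) → (∀ z → f z ≡ 0) → sum f ≡ 0
  sum-zeros f zeros = trans (sum-cong-≗ zeros) (sum-replicate-zero t)

  sum-occurrences-extendˡ : (a : Fin t) (w S : Word) →
    ∑[ z < t ] occurrences (z ∷ a ∷ w) S ≡ occurrences (a ∷ w) (drop 1 S)
  sum-occurrences-extendˡ a w []       = sum-zeros _ (λ _ → refl)
  sum-occurrences-extendˡ a w (x ∷ xs) = begin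
    ∑[ z < t ] occurrences (z ∷ a ∷ w) (x ∷ xs)
      ≡⟨ sum-cong-≗ (λ z → occurrences-cons (z ∷ a ∷ w) x xs) ⟩
    ∑[ z < t ] (isPrefix (z ∷ a ∷ w) (x ∷ xs) + occurrences (z ∷ a ∷ w) xs)
      ≡⟨ ∑-distrib-+ {t} _ _ ⟩
    ∑[ z < t ] isPrefix (z ∷ a ∷ w) (x ∷ xs) + ∑[ z < t ] occurrences (z ∷ a ∷ w) xs
      ≡⟨ cong₂ _+_ (trans (sum-single x _ (λ z z≢x → isPrefix-cons-≢ (a ∷ w) xs z≢x)) (isPrefix-cons-≡ x (a ∷ w) xs))
                   (sum-occurrences-extendˡ a w xs) ⟩
    isPrefix (a ∷ w) xs + occurrences (a ∷ w) (drop 1 xs)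
      ≡⟨ unfold xs ⟩
    occurrences (a ∷ w) xs ∎
    where
    open ≡-Reasoning
    unfold : (ys : Word) → isPrefix (a ∷ w) ys + occurrences (a ∷ w) (drop 1 ys) ≡ occurrences (a ∷ w) ys
    unfold []       = refl
    unfold (y ∷ ys) = sym (occurrences-cons (a ∷ w) y ys)

  occurrences-by-predecessor : (a : Fin t) (w : Word) (x : Fin t) (xs : Word) →
    occurrences (a ∷ w) (x ∷ xs) ≡ isPrefix (a ∷ w) (x ∷ xs) + ∑[ z < t ] occurrences (z ∷ a ∷ w) (x ∷ xs)
  occurrences-by-predecessor a w x xs =
    trans (occurrences-cons (a ∷ w) x xs) (cong (isPrefix (a ∷ w) (x ∷ xs) +_) (sym (sum-occurrences-extendˡ a w (x ∷ xs))))

  sum-isPrefix-extendʳ : (u S : Word) → length u < length S → ∑[ z < t ] isPrefix (u ++ [ z ]) S ≡ isPrefix u S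
  sum-isPrefix-extendʳ []      (s ∷ S) _ = trans (sum-single s _ (λ z z≢s → isPrefix-cons-≢ [] S z≢s)) (isPrefix-cons-≡ s [] S)
  sum-isPrefix-extendʳ (a ∷ u) (s ∷ S) (s≤s lt) = by-head (a ≟ᶠ s)
    where
    by-head : Dec (a ≡ s) → ∑[ z < t ] isPrefix (a ∷ u ++ [ z ]) (s ∷ S) ≡ isPrefix (a ∷ u) (s ∷ S)
    by-head (yes refl) = trans (sum-cong-≗ (λ z → isPrefix-cons-≡ a (u ++ [ z ]) S))
                               (trans (sum-isPrefix-extendʳ u S lt) (sym (isPrefix-cons-≡ a u S)))
    by-head (no a≢s)   = trans (sum-zeros _ (λ z → isPrefix-cons-≢ (u ++ [ z ]) S a≢s)) (sym (isPrefix-cons-≢ u S a≢s))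

  prefix-suffix-step : (w : Word) (x : Fin t) (xs : Word) →
    isPrefix w (x ∷ xs) + isSuffix w xs ≡ ∑[ z < t ] isPrefix (w ++ [ z ]) (x ∷ xs) + isSuffix w (x ∷ xs)
  prefix-suffix-step w x xs with length w ≤? length xs
  ... | yes le = begin
      isPrefix w (x ∷ xs) + isSuffix w xs
        ≡⟨ cong₂ _+_ (sym (sum-isPrefix-extendʳ w (x ∷ xs) (s≤s le)))
                     (cong (λ v → indicator (w ≟w v)) (sym (lastL-cons (length w) x xs le))) ⟩
      ∑[ z < t ] isPrefix (w ++ [ z ]) (x ∷ xs) + isSuffix w (x ∷ xs) ∎
    where open ≡-Reasoning
  ... | no ¬le = begin
      isPrefix w (x ∷ xs) + isSuffix w xs
        ≡⟨ cong (isPrefix w (x ∷ xs) +_) (indicator-no (length-≢ (subst (_< length w) (sym (cong length (lastL-short (length w) xs (<⇒≤ short)))) short))) ⟩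
      isPrefix w (x ∷ xs) + 0
        ≡⟨ +-comm _ 0 ⟩
      0 + isPrefix w (x ∷ xs)
        ≡⟨ cong₂ _+_ (sym (sum-zeros _ (λ z → indicator-no (length-≢ (length-take< (length (w ++ [ z ])) (x ∷ xs)
                                          (subst (length (x ∷ xs) <_) (sym (length-snoc w z)) (s≤s short)))))))
                     (cong (λ v → indicator (w ≟w v)) (trans (take-all (length w) (x ∷ xs) short) (sym (lastL-short (length w) (x ∷ xs) short)))) ⟩
      ∑[ z < t ] isPrefix (w ++ [ z ]) (x ∷ xs) + isSuffix w (x ∷ xs) ∎
    where
    open ≡-Reasoning
    short : length xs < length w
    short = ≰⇒> ¬le

  occurrences-by-successor : (a : Fin t) (u S : Word) →
    occurrences (a ∷ u) S ≡ ∑[ z < t ] occurrences ((a ∷ u) ++ [ z ]) S + isSuffix (a ∷ u) S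
  occurrences-by-successor a u []       = sym (cong (_+ 0) (sum-zeros _ (λ _ → refl)))
  occurrences-by-successor a u (x ∷ xs) = begin
    occurrences w (x ∷ xs)
      ≡⟨ occurrences-cons w x xs ⟩
    p + occurrences w xs
      ≡⟨ cong (p +_) (occurrences-by-successor a u xs) ⟩
    p + (O + isSuffix w xs)
      ≡⟨ solve 3 (λ p o s → p :+ (o :+ s) := o :+ (p :+ s)) refl p O (isSuffix w xs) ⟩
    O + (p + isSuffix w xs)
      ≡⟨ cong (O +_) (prefix-suffix-step w x xs) ⟩
    O + (Σp + isSuffix w (x ∷ xs))
      ≡⟨ solve 3 (λ o q s → o :+ (q :+ s) := (q :+ o) :+ s) refl O Σp (isSuffix w (x ∷ xs)) ⟩
    (Σp + O) + isSuffix w (x ∷ xs)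
      ≡⟨ cong (_+ isSuffix w (x ∷ xs)) (sym (trans (sum-cong-≗ (λ z → occurrences-cons (w ++ [ z ]) x xs)) (∑-distrib-+ {t} _ _))) ⟩
    ∑[ z < t ] occurrences (w ++ [ z ]) (x ∷ xs) + isSuffix w (x ∷ xs) ∎
    where
    open ≡-Reasoning
    open +-*-Solver
    w : Word
    w = a ∷ u
    p O Σp : ℕ
    p  = isPrefix w (x ∷ xs)
    O  = ∑[ z < t ] occurrences (w ++ [ z ]) xs
    Σp = ∑[ z < t ] isPrefix (w ++ [ z ]) (x ∷ xs)

module GenerationFacts {t : ℕ} (n r : ℕ) (P : Vec (Fin t) r → Fin t → Fin t) where
  open Generation n r P public
  open import Data.List.Membership.DecPropositional (_≟w_ {t}) using (_∈?_)

  Used : List (Fin t) → Fin t → Set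
  Used s z = (lastL (n ∸ 1) s ++ [ z ]) ∈ blocks n s

  run-invariant : (Inv : List (Fin t) → Set) → (∀ s x → Inv s → next s ≡ just x → Inv (s ++ [ x ])) →
    ∀ fuel s → Inv s → Inv (run fuel s)
  run-invariant Inv step zero       s inv = inv
  run-invariant Inv step (suc fuel) s inv with next s in eq
  ... | nothing = inv
  ... | just x  = run-invariant Inv step fuel (s ++ [ x ]) (step s x inv eq)

  firstFresh-nothing : ∀ s l → (∀ z → Used s z) → firstFresh s l ≡ nothing
  firstFresh-nothing s []      used = refl
  firstFresh-nothing s (x ∷ l) used with (lastL (n ∸ 1) s ++ [ x ]) ∈? blocks n s
  ... | yes _   = firstFresh-nothing s l used
  ... | no  ¬ux = ⊥-elim (¬ux (used x))

  firstFresh-just : ∀ s {k} (g : Fin k → Fin t) x → firstFresh s (tabulate g) ≡ just x →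
    Σ (Fin k) λ i → (x ≡ g i) × (∀ j → toℕ j < toℕ i → Used s (g j))
  firstFresh-just s {suc k} g x eq with (lastL (n ∸ 1) s ++ [ g zero ]) ∈? blocks n s
  ... | no  _ with eq
  ...   | refl = zero , refl , (λ j ())
  firstFresh-just s {suc k} g x eq | yes used₀ with firstFresh-just s (λ i → g (suc i)) x eq
  ... | i , x≡gi , earlier = suc i , x≡gi , earlier′
    where
    earlier′ : ∀ j → toℕ j < toℕ (suc i) → Used s (g j)
    earlier′ zero    _        = used₀
    earlier′ (suc j) (s≤s lt) = earlier j lt

  firstFresh-move : ∀ s z (l₁ l₂ : List (Fin t)) → Used s z →
    firstFresh s (l₁ ++ z ∷ l₂) ≡ firstFresh s (l₁ ++ l₂ ++ [ z ])
  firstFresh-move s z (x ∷ l₁) l₂ used-z with (lastL (n ∸ 1) s ++ [ x ]) ∈? blocks n s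
  ... | yes _ = firstFresh-move s z l₁ l₂ used-z
  ... | no  _ = refl
  firstFresh-move s z [] l₂ used-z with (lastL (n ∸ 1) s ++ [ z ]) ∈? blocks n s
  ... | no ¬uz = ⊥-elim (¬uz used-z)
  ... | yes _  = skip-last l₂
    where
    skip-last : ∀ l → firstFresh s l ≡ firstFresh s (l ++ [ z ])
    skip-last [] with (lastL (n ∸ 1) s ++ [ z ]) ∈? blocks n s
    ... | yes _  = refl
    ... | no ¬uz = ⊥-elim (¬uz used-z)
    skip-last (y ∷ l) with (lastL (n ∸ 1) s ++ [ y ]) ∈? blocks n s
    ... | yes _ = skip-last l
    ... | no  _ = refl

module Simulation {t : ℕ} (n r : ℕ) (P Q : Vec (Fin t) r → Fin t → Fin t) where
  private
    module A = GenerationFacts n r P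
    module B = GenerationFacts n r Q
  open import Data.List.Membership.DecPropositional (_≟w_ {t}) using (_∈?_)

  relabel-word : (f : Fin t → Fin t) → ∀ s x → lastL (n ∸ 1) (map f s) ++ [ f x ] ≡ map f (lastL (n ∸ 1) s ++ [ x ])
  relabel-word f s x = trans (cong (_++ [ f x ]) (lastL-map f (n ∸ 1) s)) (sym (map-++ f (lastL (n ∸ 1) s) [ x ]))

  firstFresh-map : (f : Fin t → Fin t) → Injective _≡_ _≡_ f → ∀ s l →
    A.firstFresh (map f s) (map f l) ≡ Maybe.map f (B.firstFresh s l)
  firstFresh-map f f-inj s []      = refl
  firstFresh-map f f-inj s (x ∷ l)
    with (lastL (n ∸ 1) (map f s) ++ [ f x ]) ∈? blocks n (map f s) | (lastL (n ∸ 1) s ++ [ x ]) ∈? blocks n s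
  ... | yes _   | yes _  = firstFresh-map f f-inj s l
  ... | no  _   | no  _  = refl
  ... | yes ufx | no ¬ux = ⊥-elim (¬ux (∈-map-map⁻ f f-inj (subst₂ _∈_ (relabel-word f s x) (blocks-map f n s) ufx)))
  ... | no ¬ufx | yes ux = ⊥-elim (¬ufx (subst₂ _∈_ (sym (relabel-word f s x)) (sym (blocks-map f n s)) (∈-map⁺ (map f) ux)))

  run-map : (f : Fin t → Fin t) (Inv : List (Fin t) → Set) →
    (∀ s x → Inv s → B.next s ≡ just x → Inv (s ++ [ x ])) →
    (∀ s → Inv s → A.next (map f s) ≡ Maybe.map f (B.next s)) →
    ∀ fuel s → Inv s → A.run fuel (map f s) ≡ map f (B.run fuel s)
  run-map f Inv step simulates zero       s inv = refl
  run-map f Inv step simulates (suc fuel) s inv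
    with B.next s in eq | A.next (map f s) | simulates s inv
  ... | nothing | .nothing       | refl = refl
  ... | just x  | .(just (f x)) | refl =
    trans (cong (A.run fuel) (sym (map-++ f s [ x ]))) (run-map f Inv step simulates fuel (s ++ [ x ]) (step s x inv eq))

permutation-injective : {k : ℕ} (π : Permutation′ k) → Injective _≡_ _≡_ (π ⟨$⟩ʳ_)
permutation-injective π {a} {b} πa≡πb = trans (sym (inverseˡ π)) (trans (cong (π ⟨$⟩ˡ_) πa≡πb) (inverseˡ π))

below-last : {k : ℕ} (j : Fin (suc k)) → j ≢ fromℕ k → toℕ j < toℕ (fromℕ k)
below-last j j≢last = ≤∧≢⇒< (≤fromℕ j) (λ eq → j≢last (toℕ-injective eq))

module Span0 {k : ℕ} (n : ℕ) (P : Vec (Fin (suc k)) 0 → Permutation′ (suc k)) where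
  open GenerationFacts n 0 (λ c i → P c ⟨$⟩ʳ i) public

  π : Permutation′ (suc k)
  π = P []

  next-tabulate : ∀ s → next s ≡ firstFresh s (tabulate (π ⟨$⟩ʳ_))
  next-tabulate s = cong (firstFresh s) (map-tabulate (λ i → i) (π ⟨$⟩ʳ_))

  Normalises : Permutation′ (suc k) → Set
  Normalises π′ = (π′ ⟨$⟩ʳ fromℕ k ≡ zero) ×
    (∀ s → zero ∈ s → next s ≡ firstFresh s (tabulate (π′ ⟨$⟩ʳ_)))

-- The least preferred symbol y of a span-0 rule, generating sequences of
-- order m + 1.  Once y has been chosen after the context y^m, every symbol
-- has been used after that context, so the process stops: a generated
-- sequence containing the block y^(m+1) ends with y^m (unless y = 0, when
-- that block is the initial one).
module LeastPreferred {k : ℕ} (m : ℕ) (P : Vec (Fin (suc k)) 0 → Permutation′ (suc k)) where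
  open Span0 (suc m) P

  y : Fin (suc k)
  y = π ⟨$⟩ʳ fromℕ k

  choosing-y-exhausts : ∀ s → m ≤ length s → next s ≡ just y →
    ∀ z → (lastL m s ++ [ z ]) ∈ blocks (suc m) (s ++ [ y ])
  choosing-y-exhausts s le chose-y z rewrite blocks-snoc m s y le with z ≟ᶠ y
  ... | yes refl = ∈-++⁺ʳ (blocks (suc m) s) (here refl)
  ... | no  z≢y  with firstFresh-just s (π ⟨$⟩ʳ_) y (trans (sym (next-tabulate s)) chose-y)
  ...   | i , y≡πi , earlier = ∈-++⁺ˡ (subst (Used s) (inverseʳ π) (earlier (π ⟨$⟩ˡ z) z-earlier))
    where
    i≡last : i ≡ fromℕ k
    i≡last = permutation-injective π (sym y≡πi)
    z-earlier : toℕ (π ⟨$⟩ˡ z) < toℕ i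
    z-earlier = subst (λ j → toℕ (π ⟨$⟩ˡ z) < toℕ j) (sym i≡last)
      (below-last (π ⟨$⟩ˡ z) (λ eq → z≢y (trans (sym (inverseʳ π)) (cong (π ⟨$⟩ʳ_) eq))))

  stuck-after-constant : ∀ s → m ≤ length s → lastL m s ≡ replicate m y → next s ≡ just y →
    next (s ++ [ y ]) ≡ nothing
  stuck-after-constant s le tail≡ chose-y =
    trans (next-tabulate (s ++ [ y ])) (firstFresh-nothing (s ++ [ y ]) _ used)
    where
    same-context : lastL m s ≡ lastL m (s ++ [ y ])
    same-context = trans tail≡ (sym (constant-suffix-snoc m y s le tail≡))
    used : ∀ z → Used (s ++ [ y ]) z
    used z = subst (λ c → (c ++ [ z ]) ∈ blocks (suc m) (s ++ [ y ])) same-context (choosing-y-exhausts s le chose-y z)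

  ConstantTail : List (Fin (suc k)) → Set
  ConstantTail s = m ≤ length s ×
    (replicate (suc m) y ∈ blocks (suc m) s → (lastL m s ≡ replicate m y) × (next s ≡ nothing))

  constantTail-step : ∀ s x → ConstantTail s → next s ≡ just x → ConstantTail (s ++ [ x ])
  constantTail-step s x (le , was-stopped) chose-x =
    subst (m ≤_) (sym (length-snoc s x)) (m≤n⇒m≤1+n le) , now-stopped
    where
    now-stopped : replicate (suc m) y ∈ blocks (suc m) (s ++ [ x ]) →
      (lastL m (s ++ [ x ]) ≡ replicate m y) × (next (s ++ [ x ]) ≡ nothing)
    now-stopped Y∈ with ∈-++⁻ (blocks (suc m) s) (subst (replicate (suc m) y ∈_) (blocks-snoc m s x le) Y∈)
    ... | inj₁ Y∈s with () ← trans (sym chose-x) (proj₂ (was-stopped Y∈s))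
    ... | inj₂ (here Y≡) with ∷ʳ-injective (replicate m y) (lastL m s) (trans (sym (replicate-snoc m y)) Y≡)
    ...   | ys≡tail , refl = constant-suffix-snoc m y s le (sym ys≡tail) , stuck-after-constant s le (sym ys≡tail) chose-x

  ends-with-constant : y ≢ zero → ∀ fuel →
    replicate (suc m) y ∈ blocks (suc m) (run fuel (replicate (suc m) zero)) →
    lastL m (run fuel (replicate (suc m) zero)) ≡ replicate m y
  ends-with-constant y≢0 fuel Y∈ =
    proj₁ (proj₂ (run-invariant ConstantTail constantTail-step fuel (replicate (suc m) zero) initial) Y∈)
    where
    initial : ConstantTail (replicate (suc m) zero)
    initial = subst (m ≤_) (sym (length-replicate (suc m))) (n≤1+n m) , λ Y∈₀ → ⊥-elim (not-initial Y∈₀)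
      where
      not-initial : ¬ (replicate (suc m) y ∈ blocks (suc m) (replicate (suc m) zero))
      not-initial Y∈₀ with here Y≡ ← subst (replicate (suc m) y ∈_) (blocks-exact (suc m) zero (replicate m zero) (length-replicate (suc m))) Y∈₀
        = y≢0 (proj₁ (∷-injective Y≡))

-- In a sequence in which every word of length m+2 occurs exactly once, a
-- word of length m+1 starts the sequence iff it ends it: it has exactly t
-- occurrences with a predecessor and exactly t with a successor.
prefix≡suffix : {t : ℕ} (m : ℕ) (x : Fin t) (xs : List (Fin t)) →
  (∀ l → length l ≡ suc (suc m) → occurrences l (x ∷ xs) ≡ 1) →
  (a : Fin t) (u : List (Fin t)) → length u ≡ m →
  Counting.isPrefix (a ∷ u) (x ∷ xs) ≡ Counting.isSuffix (a ∷ u) (x ∷ xs)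
prefix≡suffix {t} m x xs once a u u-length = +-cancelʳ-≡ t _ _ (begin
  isPrefix w S + t                                  ≡⟨ cong (isPrefix w S +_) (sym predecessors) ⟩
  isPrefix w S + ∑[ z < t ] occurrences (z ∷ w) S   ≡⟨ sym (occurrences-by-predecessor a u x xs) ⟩
  occurrences w S                                   ≡⟨ occurrences-by-successor a u S ⟩
  ∑[ z < t ] occurrences (w ++ [ z ]) S + isSuffix w S  ≡⟨ cong (_+ isSuffix w S) successors ⟩
  t + isSuffix w S                                  ≡⟨ +-comm t _ ⟩
  isSuffix w S + t                                  ∎)
  where
  open ≡-Reasoning
  open Counting {t}
  w S : List (Fin t)
  w = a ∷ u
  S = x ∷ xs
  predecessors : ∑[ z < t ] occurrences (z ∷ w) S ≡ t
  predecessors = trans (sum-cong-≗ (λ z → once (z ∷ w) (cong (λ l → suc (suc l)) u-length))) (sum-ones t)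
  successors : ∑[ z < t ] occurrences (w ++ [ z ]) S ≡ t
  successors = trans (sum-cong-≗ (λ z → once (w ++ [ z ]) (cong suc (trans (length-snoc u z) (cong suc u-length))))) (sum-ones t)

occurs-once : {t : ℕ} (n : ℕ) (S : List (Fin t)) → ((w : Vec (Fin t) n) → occurrences (toList w) S ≡ 1) →
  ∀ l → length l ≡ n → occurrences l S ≡ 1
occurs-once .(length l) S once l refl = subst (λ v → occurrences v S ≡ 1) (toList∘fromList l) (once (fromList l))

counted⇒block : {t : ℕ} (w S : List (Fin t)) → 0 < occurrences w S → w ∈ blocks (length w) S
counted⇒block w S = in-filter (blocks (length w) S)
  where
  in-filter : ∀ bs → 0 < length (filter (w ≟w_) bs) → w ∈ bs
  in-filter (b ∷ bs) positive with w ≟w b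
  ... | yes w≡b = here w≡b
  ... | no  _   = there (in-filter bs positive)

-- Otherwise the least preferred y ≠ 0 has
-- y^n as a block, so the sequence ends with y^(n-1) but starts with 0,
-- contradicting prefix≡suffix.
least-preferred-is-zero : (k m : ℕ) (P : Vec (Fin (suc k)) 0 → Permutation′ (suc k)) (S : List (Fin (suc k))) →
  ((w : Vec (Fin (suc k)) (suc (suc m))) → occurrences (toList w) S ≡ 1) →
  take (suc (suc m)) S ≡ replicate (suc (suc m)) zero →
  Span0.run (suc (suc m)) P (suc k ^ suc (suc m)) (replicate (suc (suc m)) zero) ≡ S →
  P [] ⟨$⟩ʳ fromℕ k ≡ zero
least-preferred-is-zero k m P []       once () generated
least-preferred-is-zero k m P (x ∷ xs) once starts generated with P [] ⟨$⟩ʳ fromℕ k ≟ᶠ zero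
... | yes y≡0 = y≡0
... | no  y≢0 = ⊥-elim (0≢1+n (begin
    0                                          ≡⟨ sym (isPrefix-cons-≢ (replicate m y) xs (λ y≡x → y≢0 (trans y≡x x≡0))) ⟩
    isPrefix (replicate (suc m) y) (x ∷ xs)    ≡⟨ prefix≡suffix m x xs (occurs-once n (x ∷ xs) once) y (replicate m y) (length-replicate m) ⟩
    isSuffix (replicate (suc m) y) (x ∷ xs)    ≡⟨ indicator-yes (sym (trans (cong (λ j → lastL j (x ∷ xs)) (length-replicate (suc m))) ends)) ⟩
    1                                          ∎))
  where
  open ≡-Reasoning
  open LeastPreferred (suc m) P using (y; ends-with-constant)
  open Counting {suc k}
  n : ℕ
  n = suc (suc m)
  x≡0 : x ≡ zero
  x≡0 = proj₁ (∷-injective starts)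
  Y∈ : replicate n y ∈ blocks n (x ∷ xs)
  Y∈ = subst (λ j → replicate n y ∈ blocks j (x ∷ xs)) (length-replicate n)
         (counted⇒block (replicate n y) (x ∷ xs) (subst (0 <_) (sym (occurs-once n (x ∷ xs) once (replicate n y) (length-replicate n))) (s≤s z≤n)))
  ends : lastL (suc m) (x ∷ xs) ≡ replicate (suc m) y
  ends = subst (λ s → lastL (suc m) s ≡ replicate (suc m) y) generated
           (ends-with-constant y≢0 (suc k ^ n) (subst (λ s → replicate n y ∈ blocks n s) (sym generated) Y∈))

tabulate-around : {A : Set} {k : ℕ} (g : Fin (suc k) → A) (j : Fin (suc k)) →
  ∃ λ L₁ → ∃ λ L₂ → (tabulate g ≡ L₁ ++ g j ∷ L₂) × (tabulate (λ i → g (punchIn j i)) ≡ L₁ ++ L₂)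
tabulate-around g zero = [] , tabulate (λ i → g (suc i)) , refl , refl
tabulate-around {k = suc k} g (suc j) with tabulate-around (λ i → g (suc i)) j
... | L₁ , L₂ , around , others = g zero ∷ L₁ , L₂ , cong (g zero ∷_) around , cong (g zero ∷_) others

tabulate-last : {A : Set} {k : ℕ} (g : Fin (suc k) → A) →
  tabulate g ≡ tabulate (λ i → g (punchIn (fromℕ k) i)) ++ [ g (fromℕ k) ]
tabulate-last {k = zero}  g = refl
tabulate-last {k = suc k} g = cong (g zero ∷_) (tabulate-last (λ i → g (suc i)))

-- Any preference order π can be changed into one listing 0 last and keeping
-- the order of the other symbols: first the symbols π (punchIn j i) (in the
-- order of i), where j is the position of 0, then 0.
module ZeroLast {k : ℕ} (π : Permutation′ (suc k)) where

  zero-position : Fin (suc k)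
  zero-position = π ⟨$⟩ˡ zero

  -- π′ i = π (ρ i), where ρ sends the last position to zero-position and
  -- shifts the others around it
  π′ : Permutation′ (suc k)
  π′ = insert (fromℕ k) zero-position idₚ ∘ₚ π

  π′-last : π′ ⟨$⟩ʳ fromℕ k ≡ zero
  π′-last = trans (cong (π ⟨$⟩ʳ_) (insert-at (fromℕ k) zero-position)) (inverseʳ π)
    where
    insert-at : (i j : Fin (suc k)) → insert i j idₚ ⟨$⟩ʳ i ≡ j
    insert-at i j with i ≟ᶠ i
    ... | yes _   = refl
    ... | no  i≢i = ⊥-elim (i≢i refl)

  π′-enumeration : tabulate (π′ ⟨$⟩ʳ_) ≡ tabulate (λ i → π ⟨$⟩ʳ punchIn zero-position i) ++ [ zero ]
  π′-enumeration = begin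
    tabulate (π′ ⟨$⟩ʳ_)
      ≡⟨ tabulate-last (π′ ⟨$⟩ʳ_) ⟩
    tabulate (λ i → π′ ⟨$⟩ʳ punchIn (fromℕ k) i) ++ [ π′ ⟨$⟩ʳ fromℕ k ]
      ≡⟨ cong₂ (λ l z → l ++ [ z ]) (tabulate-cong (λ i → cong (π ⟨$⟩ʳ_) (insert-punchIn (fromℕ k) zero-position idₚ i))) π′-last ⟩
    tabulate (λ i → π ⟨$⟩ʳ punchIn zero-position i) ++ [ zero ] ∎
    where open ≡-Reasoning

-- For order 1, moving 0 to the end of the preference order changes nothing,
-- as 0 is used as soon as the sequence contains it.
normalises-order1 : {k : ℕ} (P : Vec (Fin (suc k)) 0 → Permutation′ (suc k)) →
  Σ (Permutation′ (suc k)) (Span0.Normalises 1 P)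
normalises-order1 P = π′ , π′-last , same-choice
  where
  open Span0 1 P
  open ZeroLast π
  open ≡-Reasoning

  zero-used : ∀ s → zero ∈ s → Used s zero
  zero-used s 0∈s = subst (λ c → (c ++ [ zero ]) ∈ blocks 1 s) (sym (drop-all (length s ∸ 0) s ≤-refl)) (singleton-block s 0∈s)

  same-choice : ∀ s → zero ∈ s → next s ≡ firstFresh s (tabulate (π′ ⟨$⟩ʳ_))
  same-choice s 0∈s with tabulate-around (π ⟨$⟩ʳ_) zero-position
  ... | L₁ , L₂ , around , others = begin
    next s                                                                ≡⟨ next-tabulate s ⟩
    firstFresh s (tabulate (π ⟨$⟩ʳ_))                                     ≡⟨ cong (firstFresh s) (trans around (cong (λ z → L₁ ++ z ∷ L₂) (inverseʳ π))) ⟩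
    firstFresh s (L₁ ++ zero ∷ L₂)                                        ≡⟨ firstFresh-move s zero L₁ L₂ (zero-used s 0∈s) ⟩
    firstFresh s (L₁ ++ L₂ ++ [ zero ])                                   ≡⟨ cong (firstFresh s) (sym (++-assoc L₁ L₂ [ zero ])) ⟩
    firstFresh s ((L₁ ++ L₂) ++ [ zero ])                                 ≡⟨ cong (λ l → firstFresh s (l ++ [ zero ])) (sym others) ⟩
    firstFresh s (tabulate (λ i → π ⟨$⟩ʳ punchIn zero-position i) ++ [ zero ]) ≡⟨ cong (firstFresh s) (sym π′-enumeration) ⟩
    firstFresh s (tabulate (π′ ⟨$⟩ʳ_))                                    ∎

-- A normalised span-0 rule generates the Ford sequence relabelled by
-- σ = π′ ∘ opposite: σ turns Ford's preference order (t-1, …, 0) into π′,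
-- fixes 0, and the two rules make corresponding choices on sequences
-- containing 0.
relabel-ford : {k : ℕ} (m : ℕ) (P : Vec (Fin (suc k)) 0 → Permutation′ (suc k)) (π′ : Permutation′ (suc k)) →
  Span0.Normalises (suc m) P π′ →
  map ((reverse ∘ₚ π′) ⟨$⟩ʳ_) (ford (suc k) (suc m)) ≡ generate (suc k) (suc m) 0 P
relabel-ford {k} m P π′ (π′-last , same-choice) = begin
  map f (ford t n)                                ≡⟨ sym (run-map f (zero ∈_) (λ s x 0∈s _ → ∈-++⁺ˡ 0∈s) simulates (t ^ n) (replicate n zero) (here refl)) ⟩
  A.run (t ^ n) (map f (replicate n zero))        ≡⟨ cong (A.run (t ^ n)) (trans (map-replicate f n zero) (cong (replicate n) π′-last)) ⟩
  A.run (t ^ n) (replicate n zero)                ∎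
  where
  open ≡-Reasoning
  t n : ℕ
  t = suc k
  n = suc m
  module A = Span0 n P
  module B = GenerationFacts n 0 (λ _ i → opposite i)
  open Simulation n 0 (λ c i → P c ⟨$⟩ʳ i) (λ _ i → opposite i)

  f : Fin t → Fin t
  f = (reverse ∘ₚ π′) ⟨$⟩ʳ_

  ford-order : tabulate (π′ ⟨$⟩ʳ_) ≡ map f (map opposite (allFin t))
  ford-order = begin
    tabulate (π′ ⟨$⟩ʳ_)                   ≡⟨ tabulate-cong (λ i → cong (π′ ⟨$⟩ʳ_) (sym (opposite-involutive i))) ⟩
    tabulate (λ i → f (opposite i))       ≡⟨ sym (map-tabulate (λ i → i) (λ i → f (opposite i))) ⟩
    map (λ i → f (opposite i)) (allFin t) ≡⟨ map-∘ (allFin t) ⟩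
    map f (map opposite (allFin t))       ∎

  simulates : ∀ s → zero ∈ s → A.next (map f s) ≡ Maybe.map f (B.next s)
  simulates s 0∈s = begin
    A.next (map f s)                                          ≡⟨ same-choice (map f s) (subst (_∈ map f s) π′-last (∈-map⁺ f 0∈s)) ⟩
    A.firstFresh (map f s) (tabulate (π′ ⟨$⟩ʳ_))              ≡⟨ cong (A.firstFresh (map f s)) ford-order ⟩
    A.firstFresh (map f s) (map f (map opposite (allFin t)))  ≡⟨ firstFresh-map f (permutation-injective (reverse ∘ₚ π′)) s _ ⟩
    Maybe.map f (B.next s)                                    ∎

normal-form : (k m : ℕ) (P : Vec (Fin (suc k)) 0 → Permutation′ (suc k)) (S : List (Fin (suc k))) →
  ((w : Vec (Fin (suc k)) (suc m)) → occurrences (toList w) S ≡ 1) →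
  take (suc m) S ≡ replicate (suc m) zero →
  Span0.run (suc m) P (suc k ^ suc m) (replicate (suc m) zero) ≡ S →
  Σ (Permutation′ (suc k)) (Span0.Normalises (suc m) P)
normal-form k zero     P S _    _      _         = normalises-order1 P
normal-form k (suc m) P S once starts generated =
  P [] , least-preferred-is-zero k m P S once starts generated , λ s _ → Span0.next-tabulate (suc (suc m)) P s

mainTheorem8 : (t : ℕ) .{{_ : NonZero t}} → 2 ≤ t → (n : ℕ) → 1 ≤ n →
    (S : List (Fin t)) → IsDeBruijn t n S → StartsAtZero t n S → Comp₀IsZero t n S →
    Σ (Permutation′ t) λ σ → map (σ ⟨$⟩ʳ_) (ford t n) ≡ S
mainTheorem8 (suc k) _ (suc m) _ S (_ , once) starts (P , generated)
  with π′ , normalises ← normal-form k m P S once starts generated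
  = reverse ∘ₚ π′ , trans (relabel-ford m P π′ normalises) generated
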